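{- For every finite graph $G$ with at least one edge, $B'(G)\ge\min_{uv\in E(G)}\big(d(u)+d(v)-2\big)$, where $d(x)$ denotes the degree of $x$.
   Context: An edge-numbering of a graph $G$ is an assignment $f$ of distinct integers to the edges; $B'(f)$ is the maximum of $|f(e)-f(e')|$ over pairs of distinct incident edges $e,e'$. The edge-bandwidth $B'(G)$ is the minimum of $B'(f)$ over all edge-numberings $f$ of $G$. -}

module Defs where

open import Data.Nat using (ℕ; zero; suc; _∸_; _+_; _⊔_; _⊓_)
open import Data.Fin using (Fin; _≟_)
open import Data.Fin.Properties using () renaming (_≟_ to _≟F_)
open import Data.Integer using (ℤ; ∣_∣; _-_)
open import Data.List using (List; foldr; map; filter; length; cartesianProduct)
open import Data.List.Base using ()
open import Data.Fin.Base using ()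
open import Data.List using (List)
open import Data.Product using (_×_; _,_; proj₁; proj₂)
open import Data.Sum using (_⊎_)
open import Relation.Nullary using (¬_; Dec)
open import Relation.Nullary.Decidable using (_⊎-dec_; _×-dec_; ¬?)
open import Relation.Binary.PropositionalEquality using (_≡_; _≢_)
open import Function.Definitions using (Injective)
import Data.List

allFin : (n : ℕ) → List (Fin n)
allFin = Data.List.allFin

record Graph : Set where
  field
    n : ℕ
    m : ℕ
    end₁ : Fin m → Fin n
    end₂ : Fin m → Fin n
    loopless : ∀ e → end₁ e ≢ end₂ e
    noParallel : ∀ e e' → end₁ e ≡ end₁ e' → end₂ e ≡ end₂ e' → e ≡ e'
    noParallel' : ∀ e e' → end₁ e ≡ end₂ e' → end₂ e ≡ end₁ e' → e ≡ e'

module _ (G : Graph) where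
  open Graph G

  IncidentTo : Fin n → Fin m → Set
  IncidentTo x e = (x ≡ end₁ e) ⊎ (x ≡ end₂ e)

  incidentTo? : ∀ x e → Dec (IncidentTo x e)
  incidentTo? x e = (x ≟ end₁ e) ⊎-dec (x ≟ end₂ e)

  degree : Fin n → ℕ
  degree x = length (filter (λ e → incidentTo? x e) (allFin m))

  IncidentEdges : Fin m × Fin m → Set
  IncidentEdges (e , e') = (e ≢ e') × (IncidentTo (end₁ e) e' ⊎ IncidentTo (end₂ e) e')

  incidentEdges? : ∀ p → Dec (IncidentEdges p)
  incidentEdges? (e , e') = ¬? (e ≟ e') ×-dec (incidentTo? (end₁ e) e' ⊎-dec incidentTo? (end₂ e) e')

  EdgeNumbering : Set
  EdgeNumbering = Fin m → ℤ

  IsEdgeNumbering : EdgeNumbering → Set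
  IsEdgeNumbering f = Injective _≡_ _≡_ f

  -- B'(f): maximum of |f(e) - f(e')| over pairs of distinct incident edges
  -- (0 if there are no such pairs)
  B′ : EdgeNumbering → ℕ
  B′ f = foldr _⊔_ 0
           (map (λ p → ∣ f (proj₁ p) - f (proj₂ p) ∣)
                (filter incidentEdges? (cartesianProduct (allFin m) (allFin m))))

  -- B'(G) ≥ k : every edge-numbering f has B'(f) ≥ k
  -- (B'(G) is the minimum of B'(f) over all edge-numberings f)
  EdgeBandwidth≥ : ℕ → Set
  EdgeBandwidth≥ k = (f : EdgeNumbering) → IsEdgeNumbering f → k Data.Nat.≤ B′ f

  edgeValue : Fin m → ℕ
  edgeValue e = (degree (end₁ e) + degree (end₂ e)) ∸ 2

  -- min over edges uv of d(u)+d(v)-2; the argument e₀ is any edge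
  -- (witnessing that G has at least one edge); the value does not depend on it
  minEdgeValue : Fin m → ℕ
  minEdgeValue e₀ = foldr _⊓_ (edgeValue e₀) (map edgeValue (allFin m))

{-# OPTIONS --safe #-}
module Submission where

-- Let e = uv be the edge of least label under f. Every edge adjacent to e has label
-- f(e) + k with 1 ≤ k ≤ B'(f), and distinct edges get distinct k, so e has at most B'(f)
-- adjacent edges. Since e is the only edge incident to both u and v, it has at least
-- d(u) + d(v) - 2 adjacent edges.

open import Defs
open import Level using (Level; 0ℓ)
open import Data.Fin using (Fin)
open import Data.Fin.Properties using (_≟_)
open import Data.Nat using (ℕ; zero; suc; _+_; _⊔_; _⊓_; _≤_; _<_; z≤n; s≤s)
open import Data.Nat.Properties
  using ( +-suc; +-assoc; ≤-trans; ≤-reflexive; <⇒≱; ≤-pred; ≤∧≢⇒<; n≢0⇒n>0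
        ; m≤m+n; +-mono-≤; +-monoˡ-≤; +-monoʳ-≤; ∸-monoˡ-≤; m+n∸n≡m
        ; m≤m⊔n; m≤n⇒m≤o⊔n; m⊓n≤m; m≤n⇒o⊓m≤n; module ≤-Reasoning)
  renaming (_≟_ to _≟ℕ_)
open import Data.Integer as ℤ using (∣_∣; _-_; -_; +_)
open import Data.Integer.Properties as ℤ
  using (0≤i⇒+∣i∣≡i; i≤j⇒0≤j-i; ∣i-j∣≡∣j-i∣; ∣i∣≡0⇒i≡0; i-j≡0⇒i≡j)
open import Algebra.Properties.AbelianGroup ℤ.+-0-abelianGroup using (∙-cancelʳ)
open import Data.List using (List; []; _∷_; filter; length; map; foldr)
open import Data.List.Properties using (filter-none; length-map)
open import Data.List.Extrema ℤ.≤-totalOrder using (argmin; f[argmin]≤f[xs])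
open import Data.List.Membership.Propositional using (_∈_)
open import Data.List.Membership.Propositional.Properties
  using (∈-allFin; ∈-map⁺; ∈-map⁻; ∈-filter⁺; ∈-filter⁻; ∈-cartesianProduct⁺)
open import Data.List.Relation.Unary.Any using (here; there)
import Data.List.Relation.Unary.All as All
open import Data.List.Relation.Unary.AllPairs using (_∷_)
open import Data.List.Relation.Unary.Unique.Propositional using (Unique)
import Data.List.Relation.Unary.Unique.Propositional.Properties as Unique
open import Data.List.Relation.Binary.Sublist.Propositional using (⊆-refl)
open import Data.List.Relation.Binary.Sublist.Propositional.Properties
  using (length-mono-≤) renaming (filter⁺ to sublist-filter⁺)
open import Data.Bool using (true; false)
open import Data.Product using (_×_; _,_)
open import Data.Sum using (inj₁; inj₂)
open import Relation.Nullary using (yes; no; contradiction)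
open import Relation.Nullary.Decidable using (does)
open import Relation.Unary using (Pred; Decidable; _⊆_; _∪_; _∩_; ∁)
open import Relation.Unary.Properties using (_∪?_; _∩?_; ∁?)
open import Relation.Binary.Definitions using (DecidableEquality)
open import Relation.Binary.PropositionalEquality
  using (_≡_; refl; sym; trans; cong; ≢-sym; module ≡-Reasoning)

private
  variable
    a p q : Level
    A : Set a

module _ {P : Pred A p} (P? : Decidable P) where

  length-filter+length-filter-∁ : ∀ xs →
    length (filter P? xs) + length (filter (∁? P?) xs) ≡ length xs
  length-filter+length-filter-∁ []       = refl
  length-filter+length-filter-∁ (x ∷ xs)
    with ih ← length-filter+length-filter-∁ xs | does (P? x)
  ... | true  = cong suc ih
  ... | false = trans (+-suc _ _) (cong suc ih)

module _ {P : Pred A p} {Q : Pred A q} (P? : Decidable P) (Q? : Decidable Q) where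

  length-filter-∪-∩ : ∀ xs →
    length (filter P? xs) + length (filter Q? xs) ≡
    length (filter (P? ∪? Q?) xs) + length (filter (P? ∩? Q?) xs)
  length-filter-∪-∩ []       = refl
  length-filter-∪-∩ (x ∷ xs) with ih ← length-filter-∪-∩ xs | does (P? x) | does (Q? x)
  ... | true  | true  = cong suc (trans (+-suc _ _) (trans (cong suc ih) (sym (+-suc _ _))))
  ... | true  | false = cong suc ih
  ... | false | true  = trans (+-suc _ _) (cong suc ih)
  ... | false | false = ih

  length-filter-∪ : ∀ xs →
    length (filter (P? ∪? Q?) xs) ≤ length (filter P? xs) + length (filter Q? xs)
  length-filter-∪ xs = ≤-trans (m≤m+n _ _) (≤-reflexive (sym (length-filter-∪-∩ xs)))

  length-filter-mono : P ⊆ Q → ∀ xs → length (filter P? xs) ≤ length (filter Q? xs)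
  length-filter-mono P⊆Q xs =
    length-mono-≤ (sublist-filter⁺ P? Q? (λ { refl → P⊆Q }) (⊆-refl {x = xs}))

length-filter-≟≤1 : (_≟ᴬ_ : DecidableEquality A) (y : A) {xs : List A} →
                    Unique xs → length (filter (_≟ᴬ y) xs) ≤ 1
length-filter-≟≤1 _≟ᴬ_ y {[]}     _               = z≤n
length-filter-≟≤1 _≟ᴬ_ y {x ∷ xs} (x∉xs ∷ xs-uniq) with x ≟ᴬ y
... | yes refl = s≤s (≤-reflexive (cong length (filter-none (_≟ᴬ y) (All.map ≢-sym x∉xs))))
... | no  _    = length-filter-≟≤1 _≟ᴬ_ y xs-uniq

unique-bounded⇒length≤ : ∀ D {xs : List ℕ} → Unique xs →
                         (∀ {y} → y ∈ xs → 0 < y × y ≤ D) → length xs ≤ D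
unique-bounded⇒length≤ zero    {[]}    _      _       = z≤n
unique-bounded⇒length≤ zero    {x ∷ _} _      bounded with bounded (here refl)
... | 0<x , x≤0 = contradiction x≤0 (<⇒≱ 0<x)
unique-bounded⇒length≤ (suc D) {xs}    unique bounded = begin
    length xs
      ≡⟨ sym (length-filter+length-filter-∁ (_≟ℕ suc D) xs) ⟩
    length (filter (_≟ℕ suc D) xs) + length (filter ≢D? xs)
      ≤⟨ +-mono-≤ (length-filter-≟≤1 _≟ℕ_ (suc D) unique) rest≤D ⟩
    suc D ∎
  where
  open ≤-Reasoning
  ≢D? : Decidable (∁ (_≡ suc D))
  ≢D? = ∁? (_≟ℕ suc D)
  rest≤D : length (filter ≢D? xs) ≤ D
  rest≤D = unique-bounded⇒length≤ D (Unique.filter⁺ ≢D? unique) λ y∈ →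
    let y∈xs , y≢D = ∈-filter⁻ ≢D? y∈
        0<y , y≤1+D = bounded y∈xs
    in 0<y , ≤-pred (≤∧≢⇒< y≤1+D y≢D)

≤-foldr-⊔ : ∀ b {x xs} → x ∈ xs → x ≤ foldr _⊔_ b xs
≤-foldr-⊔ b {xs = y ∷ ys} (here refl) = m≤m⊔n y _
≤-foldr-⊔ b {xs = y ∷ ys} (there x∈)  = m≤n⇒m≤o⊔n y (≤-foldr-⊔ b x∈)

foldr-⊓-≤ : ∀ b {x xs} → x ∈ xs → foldr _⊓_ b xs ≤ x
foldr-⊓-≤ b {xs = y ∷ ys} (here refl) = m⊓n≤m y _
foldr-⊓-≤ b {xs = y ∷ ys} (there x∈)  = m≤n⇒o⊓m≤n y (foldr-⊓-≤ b x∈)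

∣i-k∣-injective : ∀ {i j k} → k ℤ.≤ i → k ℤ.≤ j → ∣ i - k ∣ ≡ ∣ j - k ∣ → i ≡ j
∣i-k∣-injective {i} {j} {k} k≤i k≤j eq = ∙-cancelʳ (- k) i j (begin
    i - k         ≡⟨ sym (0≤i⇒+∣i∣≡i (i≤j⇒0≤j-i k≤i)) ⟩
    + ∣ i - k ∣   ≡⟨ cong +_ eq ⟩
    + ∣ j - k ∣   ≡⟨ 0≤i⇒+∣i∣≡i (i≤j⇒0≤j-i k≤j) ⟩
    j - k         ∎)
  where open ≡-Reasoning

module _ (G : Graph) where
  open Graph G

  adjacentTo? : ∀ e → Decidable (λ x → IncidentEdges G (e , x))
  adjacentTo? e x = incidentEdges? G (e , x)

  adjacentEdges : Fin m → List (Fin m)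
  adjacentEdges e = filter (adjacentTo? e) (allFin m)

  incident-to-both-ends⇒≡ : ∀ e x →
    IncidentTo G (end₁ e) x → IncidentTo G (end₂ e) x → x ≡ e
  incident-to-both-ends⇒≡ e x (inj₁ a) (inj₁ b) = contradiction (trans a (sym b)) (loopless e)
  incident-to-both-ends⇒≡ e x (inj₁ a) (inj₂ b) = sym (noParallel e x a b)
  incident-to-both-ends⇒≡ e x (inj₂ a) (inj₁ b) = sym (noParallel' e x a b)
  incident-to-both-ends⇒≡ e x (inj₂ a) (inj₂ b) = contradiction (trans a (sym b)) (loopless e)

  degree-end₁+degree-end₂≤ : ∀ e →
    degree G (end₁ e) + degree G (end₂ e) ≤ length (adjacentEdges e) + 2
  degree-end₁+degree-end₂≤ e = begin
      # at₁? + # at₂?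
        ≡⟨ length-filter-∪-∩ at₁? at₂? (allFin m) ⟩
      # (at₁? ∪? at₂?) + # (at₁? ∩? at₂?)
        ≤⟨ +-mono-≤ (length-filter-mono _ _ at-end⇒adjacent-or-e (allFin m))
                    (length-filter-mono _ _ at-both⇒e (allFin m)) ⟩
      # (adjacent? ∪? is-e?) + # is-e?
        ≤⟨ +-monoˡ-≤ _ (length-filter-∪ adjacent? is-e? (allFin m)) ⟩
      # adjacent? + # is-e? + # is-e?
        ≤⟨ +-mono-≤ (+-monoʳ-≤ (# adjacent?) #is-e≤1) #is-e≤1 ⟩
      # adjacent? + 1 + 1
        ≡⟨ +-assoc (# adjacent?) 1 1 ⟩
      # adjacent? + 2 ∎
    where
    open ≤-Reasoning
    # : {P : Pred (Fin m) 0ℓ} → Decidable P → ℕ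
    # P? = length (filter P? (allFin m))
    at₁? : Decidable (IncidentTo G (end₁ e))
    at₁? = incidentTo? G (end₁ e)
    at₂? : Decidable (IncidentTo G (end₂ e))
    at₂? = incidentTo? G (end₂ e)
    adjacent? : Decidable (λ x → IncidentEdges G (e , x))
    adjacent? = adjacentTo? e
    is-e? : Decidable (_≡ e)
    is-e? = _≟ e
    #is-e≤1 : # is-e? ≤ 1
    #is-e≤1 = length-filter-≟≤1 _≟_ e (Unique.allFin⁺ m)
    at-both⇒e : IncidentTo G (end₁ e) ∩ IncidentTo G (end₂ e) ⊆ (_≡ e)
    at-both⇒e (at₁ , at₂) = incident-to-both-ends⇒≡ e _ at₁ at₂
    at-end⇒adjacent-or-e : IncidentTo G (end₁ e) ∪ IncidentTo G (end₂ e) ⊆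
                           (λ x → IncidentEdges G (e , x)) ∪ (_≡ e)
    at-end⇒adjacent-or-e {x} at-end with x ≟ e
    ... | yes x≡e = inj₂ x≡e
    ... | no  x≢e = inj₁ (≢-sym x≢e , at-end)

  edgeValue≤length-adjacentEdges : ∀ e → edgeValue G e ≤ length (adjacentEdges e)
  edgeValue≤length-adjacentEdges e =
    ≤-trans (∸-monoˡ-≤ 2 (degree-end₁+degree-end₂≤ e)) (≤-reflexive (m+n∸n≡m _ 2))

  minEdgeValue≤edgeValue : ∀ e₀ e → minEdgeValue G e₀ ≤ edgeValue G e
  minEdgeValue≤edgeValue e₀ e = foldr-⊓-≤ (edgeValue G e₀) (∈-map⁺ (edgeValue G) (∈-allFin e))

  ∣f-f∣≤B′ : ∀ f {e x} → IncidentEdges G (e , x) → ∣ f e - f x ∣ ≤ B′ G f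
  ∣f-f∣≤B′ f {e} {x} adjacent = ≤-foldr-⊔ 0 (∈-map⁺ _
    (∈-filter⁺ (incidentEdges? G) (∈-cartesianProduct⁺ (∈-allFin e) (∈-allFin x)) adjacent))

  length-adjacentEdges≤B′ : ∀ f → IsEdgeNumbering G f → ∀ e → (∀ x → f e ℤ.≤ f x) →
                            length (adjacentEdges e) ≤ B′ G f
  length-adjacentEdges≤B′ f f-injective e f-minimal = begin
      length (adjacentEdges e)
        ≡⟨ sym (length-map gap (adjacentEdges e)) ⟩
      length (map gap (adjacentEdges e))
        ≤⟨ unique-bounded⇒length≤ (B′ G f) gaps-unique gaps-bounded ⟩
      B′ G f ∎
    where
    open ≤-Reasoning
    gap : Fin m → ℕ
    gap x = ∣ f x - f e ∣
    gap-injective : ∀ {x y} → gap x ≡ gap y → x ≡ y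
    gap-injective eq = f-injective (∣i-k∣-injective (f-minimal _) (f-minimal _) eq)
    gaps-unique : Unique (map gap (adjacentEdges e))
    gaps-unique = Unique.map⁺ gap-injective (Unique.filter⁺ _ (Unique.allFin⁺ m))
    gaps-bounded : ∀ {y} → y ∈ map gap (adjacentEdges e) → 0 < y × y ≤ B′ G f
    gaps-bounded y∈ with ∈-map⁻ gap y∈
    ... | x , x∈ , refl with ∈-filter⁻ (adjacentTo? e) {xs = allFin m} x∈
    ... | _ , adjacent@(e≢x , _) =
      n≢0⇒n>0 (λ gap≡0 → e≢x (sym (f-injective (i-j≡0⇒i≡j _ _ (∣i∣≡0⇒i≡0 gap≡0))))) ,
      ≤-trans (≤-reflexive (∣i-j∣≡∣j-i∣ (f x) (f e))) (∣f-f∣≤B′ f adjacent)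

corollary4 : (G : Graph) → (e₀ : Fin (Graph.m G)) → EdgeBandwidth≥ G (minEdgeValue G e₀)
corollary4 G e₀ f f-injective = begin
    minEdgeValue G e₀            ≤⟨ minEdgeValue≤edgeValue G e₀ e ⟩
    edgeValue G e                ≤⟨ edgeValue≤length-adjacentEdges G e ⟩
    length (adjacentEdges G e)   ≤⟨ length-adjacentEdges≤B′ G f f-injective e f-minimal ⟩
    B′ G f                       ∎
  where
  open ≤-Reasoning
  open Graph G using (m)
  e : Fin m
  e = argmin f e₀ (allFin m)
  f-minimal : ∀ x → f e ℤ.≤ f x
  f-minimal x = All.lookup (f[argmin]≤f[xs] e₀ (allFin m)) (∈-allFin x)
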